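{- Let $\mathcal{G}=(\mathcal{V},\mathcal{E})$ be a finite undirected graph with nonempty node set, with nonnegative edge weights $\mathcal{S}_{i,j}\ge0$ for $(u_i,u_j)\in\mathcal{E}$ and nonnegative node weights $\mathcal{S}_i\ge 0$ for $u_i\in\mathcal{V}$. For nonempty $Q\subseteq\mathcal{V}$ define $$\mathcal{F}_{[Q]}=\frac{\sum_{(u_i,u_j)\in\mathcal{E},\,u_i,u_j\in Q}\mathcal{S}_{i,j}+\sum_{u_i\in Q}\mathcal{S}_i}{|Q|},\qquad w(u_i,[Q])=\sum_{u_j\in Q,\,(u_i,u_j)\in\mathcal{E}}\mathcal{S}_{i,j}+\mathcal{S}_i\quad(u_i\in Q).$$ Consider the following procedure (Algorithm 2). Set $\mathcal{V}_c=\mathcal{V}$ and record $\mathcal{V}_c$. While $\mathcal{V}_c\neq\emptyset$: let $Q'=\mathcal{V}_c$, compute $R=\{u\in Q': w(u,[Q'])\le \frac{1}{|Q'|}\sum_{v\in Q'}w(v,[Q'])\}$, sort $R$ in increasing order of $w(\cdot,[Q'])$, and then remove the nodes of $R$ from $\mathcal{V}_c$ one at a time in this order, recording the current set $\mathcal{V}_c$ after each removal whenever it is nonempty. Finally output $Q$, a recorded nonempty set maximizing $\mathcal{F}_{[Q]}$ among all recorded sets. Let $Q^*$ be a nonempty subset of $\mathcal{V}$ maximizing $\mathcal{F}_{[Q^*]}$. Then $\mathcal{F}_{[Q]}\ge\frac12\mathcal{F}_{[Q^*]}$.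
   Context: $[Q]$ denotes the subgraph of $\mathcal{G}$ induced by the node set $Q$. The quantity $\frac{1}{|Q'|}\sum_{v\in Q'}w(v,[Q'])$ equals $\frac{2\sum_{\text{edges in }[Q']}\mathcal{S}_{i,j}+\sum_{u_i\in Q'}\mathcal{S}_i}{|Q'|}$; since $R$ always contains a node of minimal $w$, the set $R$ is nonempty and the procedure terminates.
   Formalization: The edge weights $\mathcal{S}_{i,j}$ and the node weights $\mathcal{S}_i$ are rational. -}

module Defs where

open import Data.Nat using (ℕ; zero; suc)
import Data.Nat as ℕ
open import Data.Bool using (Bool; true; false; _∧_; if_then_else_)
open import Data.Fin using (Fin; toℕ)
import Data.Fin as F
open import Data.Fin.Subset using (Subset; _∈_; _-_; ∣_∣; Nonempty; Empty; ⊤)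
open import Data.Vec using (lookup)
open import Data.List using (List; []; _∷_; _++_)
open import Data.List.Relation.Unary.Unique.Propositional using (Unique)
open import Data.List.Relation.Unary.Linked using (Linked)
import Data.List.Membership.Propositional as LM
open import Data.Integer using (+_)
open import Data.Rational using (ℚ; 0ℚ; _+_; _*_; _/_; _≤_)
open import Data.Product using (_×_)
open import Function.Bundles using (_⇔_)
open import Relation.Binary.PropositionalEquality using (_≡_)

∑ : ∀ {n} → (Fin n → ℚ) → ℚ
∑ {zero}  f = 0ℚ
∑ {suc n} f = f F.zero + ∑ {n} (λ i → f (F.suc i))

[_]ℚ : Bool → ℚ → ℚ
[ b ]ℚ x = if b then x else 0ℚ

-- x / k  (convention: 0 when k = 0; only ever used with k = |Q| for nonempty Q)
avg : ℚ → ℕ → ℚ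
avg x zero    = 0ℚ
avg x (suc k) = x * ((+ 1) / suc k)

record WGraph (n : ℕ) : Set where
  field
    adj       : Fin n → Fin n → Bool
    adj-sym   : ∀ i j → adj i j ≡ adj j i
    adj-irr   : ∀ i → adj i i ≡ false
    S₂        : Fin n → Fin n → ℚ             -- edge weights S_{i,j} (only used on edges)
    S₂-sym    : ∀ i j → adj i j ≡ true → S₂ i j ≡ S₂ j i
    S₂-nonneg : ∀ i j → adj i j ≡ true → 0ℚ ≤ S₂ i j
    S₁        : Fin n → ℚ
    S₁-nonneg : ∀ i → 0ℚ ≤ S₁ i

module _ {n : ℕ} (G : WGraph n) where
  open WGraph G

  -- Σ_{(u_i,u_j) ∈ E, u_i,u_j ∈ Q} S_{i,j}, each undirected edge counted once (i < j)
  edgeSum : Subset n → ℚ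
  edgeSum Q = ∑ λ i → ∑ λ j →
    [ (toℕ i ℕ.<ᵇ toℕ j) ∧ adj i j ∧ lookup Q i ∧ lookup Q j ]ℚ (S₂ i j)

  nodeSum : Subset n → ℚ
  nodeSum Q = ∑ λ i → [ lookup Q i ]ℚ (S₁ i)

  𝓕 : Subset n → ℚ
  𝓕 Q = avg (edgeSum Q + nodeSum Q) ∣ Q ∣

  w : Fin n → Subset n → ℚ
  w i Q = (∑ λ j → [ adj i j ∧ lookup Q j ]ℚ (S₂ i j)) + S₁ i

  avgW : Subset n → ℚ
  avgW Q = avg (∑ λ v → [ lookup Q v ]ℚ (w v Q)) ∣ Q ∣

  InR : Subset n → Fin n → Set
  InR Q' u = u ∈ Q' × w u Q' ≤ avgW Q'

  SortedR : Subset n → List (Fin n) → Set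
  SortedR Q' L = Unique L × (∀ u → (u LM.∈ L) ⇔ InR Q' u)
               × Linked (λ a b → w a Q' ≤ w b Q') L

  removals : Subset n → List (Fin n) → List (Subset n)
  removals S []       = []
  removals S (x ∷ xs) = (S - x) ∷ removals (S - x) xs

  removeAll : Subset n → List (Fin n) → Subset n
  removeAll S []       = S
  removeAll S (x ∷ xs) = removeAll (S - x) xs

  -- Run Vc recs : a possible execution of the while loop started with current set Vc,
  -- recording the list recs of sets (possibly also the final empty set, which is
  -- harmless since the output is chosen among the nonempty recorded sets).
  -- Ties in the sort may be broken arbitrarily.
  data Run : Subset n → List (Subset n) → Set where
    stop : ∀ {Vc} → Empty Vc → Run Vc []
    step : ∀ {Vc L recs} → Nonempty Vc → SortedR Vc L →
           Run (removeAll Vc L) recs →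
           Run Vc (removals Vc L ++ recs)

{-# OPTIONS --safe #-}
module Submission where

open import Defs
open import Data.Nat using (ℕ; zero; suc)
import Data.Nat as ℕ
import Data.Nat.Properties as ℕ
import Data.Nat.Coprimality as Coprime
import Data.Integer as ℤ
import Data.Integer.Properties as ℤ
open import Data.Rational using (ℚ; mkℚ; 0ℚ; 1ℚ; ½; _+_; _*_; _/_; _≤_; -_; 1/_)
open import Data.Rational.Properties
open import Data.Rational.Solver using (module +-*-Solver)
open import Data.Bool using (true; false; _∧_)
open import Data.Bool.Properties using (∧-comm)
open import Data.Fin using (Fin; toℕ)
import Data.Fin as Fin
import Data.Fin.Properties as Fin
open import Data.Fin.Subset using (Subset; Nonempty; ⊤; ⊥; _-_; _─_; ⁅_⁆; _⊆_; ∣_∣; inside; outside)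
  renaming (_∈_ to _∈ₛ_)
open import Data.Fin.Subset.Properties
  using (p─⊥≡p; p─q⊆p; drop-∷-⊆; nonempty?; Empty-unique; ∣⊥∣≡0; _∈?_; x∈p∧x≢y⇒x∈p-y; ⊆⊤)
open import Data.Vec using ([]; _∷_; lookup)
import Data.Vec as Vec
open import Data.List using (List; []; _∷_; _++_)
open import Data.List.Membership.Propositional using (_∈_)
open import Data.List.Membership.Propositional.Properties using (∈-++⁺ˡ; ∈-++⁺ʳ)
open import Data.List.Relation.Unary.Any using (here; there)
open import Data.Product using (_×_; _,_; ∃-syntax)
import Data.Product as Product
open import Data.Sum using (_⊎_; inj₁; inj₂)
import Data.Sum as Sum
open import Function using (_∘_; _∘′_)
open import Function.Bundles using (Equivalence)
open import Relation.Nullary using (contradiction; yes; no)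
open import Relation.Nullary.Reflects using (ofʸ; ofⁿ)
open import Relation.Binary.PropositionalEquality using (_≡_; refl; cong; cong₂; trans; sym; module ≡-Reasoning)
open import Algebra.Bundles using (CommutativeMonoid)
open import Algebra.Properties.Group +-0-group using (\\-leftDividesʳ)
open import Algebra.Properties.CommutativeSemigroup
  (CommutativeMonoid.commutativeSemigroup +-0-commutativeMonoid) using (interchange)
open import Algebra.Properties.CommutativeMonoid.Sum +-0-commutativeMonoid
  using (sum; sum-cong-≗; sum-replicate-zero)
  renaming (∑-distrib-+ to sum-distrib-+; ∑-comm to sum-comm)

-- Let mass(Q) be the total edge and node weight of [Q], so that F[Q] = mass(Q)/|Q|.  If Q* is
-- densest and u ∈ Q*, then mass(Q*) ≤ mass(Q* - u) + w(u,[Q*]) together with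
-- F[Q* - u] ≤ F[Q*] forces F[Q*] ≤ w(u,[Q*]).  The first iteration whose set R contains a
-- node u of Q* starts from a recorded set Vc ⊇ Q*, and by the handshake identity
-- Σ_{v ∈ Vc} w(v,[Vc]) = 2·(edge weight) + (node weight) ≤ 2·mass(Vc).  Hence
--   F[Q*] ≤ w(u,[Q*]) ≤ w(u,[Vc]) ≤ (1/|Vc|) Σ_{v ∈ Vc} w(v,[Vc]) ≤ 2·F[Vc] ≤ 2·F[Q].

+-cancelˡ-≤ : ∀ r {p q} → r + p ≤ r + q → p ≤ q
+-cancelˡ-≤ r {p} {q} r+p≤r+q = begin
  p              ≡⟨ \\-leftDividesʳ r p ⟨
  - r + (r + p)  ≤⟨ +-monoʳ-≤ (- r) r+p≤r+q ⟩
  - r + (r + q)  ≡⟨ \\-leftDividesʳ r q ⟩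
  q              ∎
  where open ≤-Reasoning

p≤p+q : ∀ {p q} → 0ℚ ≤ q → p ≤ p + q
p≤p+q {p} 0≤q = ≤-trans (≤-reflexive (sym (+-identityʳ p))) (+-monoʳ-≤ p 0≤q)

½*[x+x]≡x : ∀ x → ½ * (x + x) ≡ x
½*[x+x]≡x = solve 1 (λ x → con ½ :* (x :+ x) := x) refl
  where open +-*-Solver

fromℕ : ℕ → ℚ
fromℕ n = mkℚ (ℤ.+ n) 0 (Coprime.sym (Coprime.1-coprimeTo n))

fromℕ-suc : ∀ n → fromℕ (suc n) ≡ fromℕ n + 1ℚ
fromℕ-suc n = sym (begin
  fromℕ n + 1ℚ                     ≡⟨⟩
  (ℤ.+ n ℤ.* ℤ.+ 1 ℤ.+ ℤ.+ 1) / 1  ≡⟨ cong (λ m → (m ℤ.+ ℤ.+ 1) / 1) (ℤ.*-identityʳ (ℤ.+ n)) ⟩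
  (ℤ.+ n ℤ.+ ℤ.+ 1) / 1            ≡⟨ cong (λ m → ℤ.+ m / 1) (ℕ.+-comm n 1) ⟩
  ℤ.+ suc n / 1                    ≡⟨ normalize-coprime _ ⟩
  fromℕ (suc n)                    ∎)
  where open ≡-Reasoning

avg-suc : ∀ x k → avg x (suc k) ≡ x * 1/ fromℕ (suc k)
avg-suc x k = cong (x *_) (normalize-coprime (Coprime.1-coprimeTo (suc k)))

avg-*-fromℕ : ∀ x k → avg x (suc k) * fromℕ (suc k) ≡ x
avg-*-fromℕ x k = begin
  avg x (suc k) * n  ≡⟨ cong (_* n) (avg-suc x k) ⟩
  x * 1/ n * n       ≡⟨ *-assoc x (1/ n) n ⟩
  x * (1/ n * n)     ≡⟨ cong (x *_) (*-inverseˡ n) ⟩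
  x * 1ℚ             ≡⟨ *-identityʳ x ⟩
  x                  ∎
  where
  open ≡-Reasoning
  n = fromℕ (suc k)

avg-mono-≤ : ∀ {x y} k → x ≤ y → avg x k ≤ avg y k
avg-mono-≤         zero    x≤y = ≤-refl
avg-mono-≤ {x} {y} (suc k) x≤y rewrite avg-suc x k | avg-suc y k =
  *-monoʳ-≤-nonNeg (1/ fromℕ (suc k)) x≤y

avg-distrib-+ : ∀ x y k → avg (x + y) k ≡ avg x k + avg y k
avg-distrib-+ x y zero    = sym (+-identityʳ 0ℚ)
avg-distrib-+ x y (suc k) = *-distribʳ-+ _ x y

avg-≤⇒≤-* : ∀ {x c k a} → k ≡ suc a → avg x k ≤ c → x ≤ c * fromℕ k
avg-≤⇒≤-* {x} {c} {k = suc k} refl avg≤c = begin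
  x                              ≡⟨ avg-*-fromℕ x k ⟨
  avg x (suc k) * fromℕ (suc k)  ≤⟨ *-monoʳ-≤-nonNeg (fromℕ (suc k)) avg≤c ⟩
  c * fromℕ (suc k)              ∎
  where open ≤-Reasoning

avg-peel : ∀ {x y z k} a → k ≡ suc a → y ≤ avg x k * fromℕ a → x ≤ y + z → avg x k ≤ z
avg-peel {x} {y} {z} a refl y≤ca x≤y+z = +-cancelˡ-≤ (c * fromℕ a) (begin
  c * fromℕ a + c       ≡⟨ cong (c * fromℕ a +_) (*-identityʳ c) ⟨
  c * fromℕ a + c * 1ℚ  ≡⟨ *-distribˡ-+ c (fromℕ a) 1ℚ ⟨
  c * (fromℕ a + 1ℚ)    ≡⟨ cong (c *_) (fromℕ-suc a) ⟨
  c * fromℕ (suc a)     ≡⟨ avg-*-fromℕ x a ⟩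
  x                     ≤⟨ x≤y+z ⟩
  y + z                 ≤⟨ +-monoˡ-≤ z y≤ca ⟩
  c * fromℕ a + z       ∎)
  where
  open ≤-Reasoning
  c = avg x (suc a)

guard-0 : ∀ b → [ b ]ℚ 0ℚ ≡ 0ℚ
guard-0 true  = refl
guard-0 false = refl

guard-∧ : ∀ b c x → [ b ∧ c ]ℚ x ≡ [ b ]ℚ ([ c ]ℚ x)
guard-∧ true  c x = refl
guard-∧ false c x = refl

guard-comm : ∀ b c x → [ b ]ℚ ([ c ]ℚ x) ≡ [ c ]ℚ ([ b ]ℚ x)
guard-comm b c x = begin
  [ b ]ℚ ([ c ]ℚ x)  ≡⟨ guard-∧ b c x ⟨
  [ b ∧ c ]ℚ x       ≡⟨ cong (λ d → [ d ]ℚ x) (∧-comm b c) ⟩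
  [ c ∧ b ]ℚ x       ≡⟨ guard-∧ c b x ⟩
  [ c ]ℚ ([ b ]ℚ x)  ∎
  where open ≡-Reasoning

guard-+ : ∀ b x y → [ b ]ℚ (x + y) ≡ [ b ]ℚ x + [ b ]ℚ y
guard-+ true  x y = refl
guard-+ false x y = sym (+-identityʳ 0ℚ)

guard-nonneg : ∀ b {x} → 0ℚ ≤ x → 0ℚ ≤ [ b ]ℚ x
guard-nonneg true  0≤x = 0≤x
guard-nonneg false 0≤x = ≤-refl

guard-≤ : ∀ b {x} → 0ℚ ≤ x → [ b ]ℚ x ≤ x
guard-≤ true  0≤x = ≤-refl
guard-≤ false 0≤x = 0≤x

guard-mono-≤ : ∀ b {x y} → x ≤ y → [ b ]ℚ x ≤ [ b ]ℚ y
guard-mono-≤ true  x≤y = x≤y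
guard-mono-≤ false x≤y = ≤-refl

∑≡sum : ∀ {n} (f : Fin n → ℚ) → ∑ f ≡ sum f
∑≡sum {zero}  f = refl
∑≡sum {suc n} f = cong (f Fin.zero +_) (∑≡sum (f ∘ Fin.suc))

∑-cong : ∀ {n} {f g : Fin n → ℚ} → (∀ i → f i ≡ g i) → ∑ f ≡ ∑ g
∑-cong {f = f} {g} f≗g = trans (∑≡sum f) (trans (sum-cong-≗ f≗g) (sym (∑≡sum g)))

∑-zero : ∀ n → ∑ {n} (λ _ → 0ℚ) ≡ 0ℚ
∑-zero n = trans (∑≡sum {n} _) (sum-replicate-zero n)

∑-distrib-+ : ∀ {n} (f g : Fin n → ℚ) → ∑ (λ i → f i + g i) ≡ ∑ f + ∑ g
∑-distrib-+ {n} f g =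
  trans (∑≡sum {n} _) (trans (sum-distrib-+ f g) (sym (cong₂ _+_ (∑≡sum f) (∑≡sum g))))

∑-comm : ∀ {m n} (f : Fin m → Fin n → ℚ) → ∑ (λ i → ∑ (f i)) ≡ ∑ (λ j → ∑ (λ i → f i j))
∑-comm {m} {n} f = begin
  ∑ (λ i → ∑ (f i))              ≡⟨ trans (∑-cong (λ i → ∑≡sum (f i))) (∑≡sum {m} _) ⟩
  sum (λ i → sum (f i))          ≡⟨ sum-comm f ⟩
  sum (λ j → sum (λ i → f i j))  ≡⟨ trans (∑-cong (λ j → ∑≡sum (λ i → f i j))) (∑≡sum {n} _) ⟨
  ∑ (λ j → ∑ (λ i → f i j))      ∎
  where open ≡-Reasoning

guard-∑ : ∀ {n} b (f : Fin n → ℚ) → [ b ]ℚ (∑ f) ≡ ∑ (λ i → [ b ]ℚ (f i))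
guard-∑     true  f = refl
guard-∑ {n} false f = sym (∑-zero n)

subsetSum : ∀ {n} → Subset n → (Fin n → ℚ) → ℚ
subsetSum Q f = ∑ λ i → [ lookup Q i ]ℚ (f i)

subsetSum-cong : ∀ {n} (Q : Subset n) {f g} → (∀ i → f i ≡ g i) → subsetSum Q f ≡ subsetSum Q g
subsetSum-cong Q f≗g = ∑-cong (λ i → cong [ lookup Q i ]ℚ (f≗g i))

subsetSum-distrib-+ : ∀ {n} (Q : Subset n) f g →
                      subsetSum Q (λ i → f i + g i) ≡ subsetSum Q f + subsetSum Q g
subsetSum-distrib-+ Q f g = trans (∑-cong (λ i → guard-+ (lookup Q i) (f i) (g i)))
  (∑-distrib-+ (λ i → [ lookup Q i ]ℚ (f i)) (λ i → [ lookup Q i ]ℚ (g i)))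

subsetSum-comm : ∀ {n} (Q P : Subset n) (t : Fin n → Fin n → ℚ) →
                 subsetSum Q (λ i → subsetSum P (t i)) ≡ subsetSum P (λ j → subsetSum Q (λ i → t i j))
subsetSum-comm Q P t = begin
  subsetSum Q (λ i → subsetSum P (t i))
    ≡⟨ ∑-cong (λ i → guard-∑ (lookup Q i) (λ j → [ lookup P j ]ℚ (t i j))) ⟩
  ∑ (λ i → ∑ (λ j → [ lookup Q i ]ℚ ([ lookup P j ]ℚ (t i j))))
    ≡⟨ ∑-comm (λ i j → [ lookup Q i ]ℚ ([ lookup P j ]ℚ (t i j))) ⟩
  ∑ (λ j → ∑ (λ i → [ lookup Q i ]ℚ ([ lookup P j ]ℚ (t i j))))
    ≡⟨ ∑-cong (λ j → ∑-cong (λ i → guard-comm (lookup Q i) (lookup P j) (t i j))) ⟩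
  ∑ (λ j → ∑ (λ i → [ lookup P j ]ℚ ([ lookup Q i ]ℚ (t i j))))
    ≡⟨ ∑-cong (λ j → guard-∑ (lookup P j) (λ i → [ lookup Q i ]ℚ (t i j))) ⟨
  subsetSum P (λ j → subsetSum Q (λ i → t i j))
    ∎
  where open ≡-Reasoning

subsetSum-⊥ : ∀ {n} (f : Fin n → ℚ) → subsetSum ⊥ f ≡ 0ℚ
subsetSum-⊥ {zero}  f = refl
subsetSum-⊥ {suc n} f = trans (+-identityˡ _) (subsetSum-⊥ (f ∘ Fin.suc))

subsetSum-nonneg : ∀ {n} (Q : Subset n) {f} → (∀ i → 0ℚ ≤ f i) → 0ℚ ≤ subsetSum Q f
subsetSum-nonneg []      f≥0 = ≤-refl
subsetSum-nonneg (s ∷ Q) f≥0 =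
  +-mono-≤ (guard-nonneg s (f≥0 Fin.zero)) (subsetSum-nonneg Q (f≥0 ∘ Fin.suc))

subsetSum-mono-≤ : ∀ {n} (Q : Subset n) {f g} → (∀ i → f i ≤ g i) → subsetSum Q f ≤ subsetSum Q g
subsetSum-mono-≤ []      f≤g = ≤-refl
subsetSum-mono-≤ (s ∷ Q) f≤g =
  +-mono-≤ (guard-mono-≤ s (f≤g Fin.zero)) (subsetSum-mono-≤ Q (f≤g ∘ Fin.suc))

subsetSum-mono-⊆ : ∀ {n} {Q P : Subset n} {f} → (∀ i → 0ℚ ≤ f i) → Q ⊆ P →
                   subsetSum Q f ≤ subsetSum P f
subsetSum-mono-⊆ {Q = []}          {[]}        f≥0 Q⊆P = ≤-refl
subsetSum-mono-⊆ {Q = outside ∷ Q} {t ∷ P}     f≥0 Q⊆P =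
  +-mono-≤ (guard-nonneg t (f≥0 Fin.zero)) (subsetSum-mono-⊆ (f≥0 ∘ Fin.suc) (drop-∷-⊆ Q⊆P))
subsetSum-mono-⊆ {Q = inside ∷ Q}  {t ∷ P} {f} f≥0 Q⊆P with Q⊆P Vec.here
... | Vec.here = +-monoʳ-≤ (f Fin.zero) (subsetSum-mono-⊆ (f≥0 ∘ Fin.suc) (drop-∷-⊆ Q⊆P))

subsetSum-remove : ∀ {n} (Q : Subset n) u {f} → (∀ i → 0ℚ ≤ f i) →
                   subsetSum Q f ≤ subsetSum (Q - u) f + f u
subsetSum-remove (s ∷ Q) Fin.zero {f} f≥0 = begin
  [ s ]ℚ x + subsetSum Q g      ≤⟨ +-monoˡ-≤ (subsetSum Q g) (guard-≤ s (f≥0 Fin.zero)) ⟩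
  x + subsetSum Q g             ≡⟨ +-comm x (subsetSum Q g) ⟩
  subsetSum Q g + x             ≡⟨ cong (λ R → subsetSum R g + x) (p─⊥≡p Q) ⟨
  subsetSum (Q ─ ⊥) g + x       ≡⟨ cong (_+ x) (+-identityˡ (subsetSum (Q ─ ⊥) g)) ⟨
  0ℚ + subsetSum (Q ─ ⊥) g + x  ∎
  where
  open ≤-Reasoning
  x = f Fin.zero
  g = f ∘ Fin.suc
subsetSum-remove (s ∷ Q) (Fin.suc u) {f} f≥0 = begin
  [ s ]ℚ x + subsetSum Q g                ≤⟨ +-monoʳ-≤ ([ s ]ℚ x) (subsetSum-remove Q u (f≥0 ∘ Fin.suc)) ⟩
  [ s ]ℚ x + (subsetSum (Q - u) g + g u)  ≡⟨ +-assoc ([ s ]ℚ x) (subsetSum (Q - u) g) (g u) ⟨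
  [ s ]ℚ x + subsetSum (Q - u) g + g u    ∎
  where
  open ≤-Reasoning
  x = f Fin.zero
  g = f ∘ Fin.suc

∣p∣≡1+∣p-x∣ : ∀ {n} {p : Subset n} {x} → x ∈ₛ p → ∣ p ∣ ≡ suc ∣ p - x ∣
∣p∣≡1+∣p-x∣ {p = inside  ∷ p} Vec.here        = cong (suc ∘′ ∣_∣) (sym (p─⊥≡p p))
∣p∣≡1+∣p-x∣ {p = inside  ∷ p} (Vec.there x∈p) = cong suc (∣p∣≡1+∣p-x∣ x∈p)
∣p∣≡1+∣p-x∣ {p = outside ∷ p} (Vec.there x∈p) = ∣p∣≡1+∣p-x∣ x∈p

pairSum : ∀ {n} → Subset n → (Fin n → Fin n → ℚ) → ℚ
pairSum Q t = subsetSum Q (λ i → subsetSum Q (t i))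

pairSum-distrib-+ : ∀ {n} (Q : Subset n) t t′ →
                    pairSum Q (λ i j → t i j + t′ i j) ≡ pairSum Q t + pairSum Q t′
pairSum-distrib-+ Q t t′ = trans (subsetSum-cong Q (λ i → subsetSum-distrib-+ Q (t i) (t′ i)))
  (subsetSum-distrib-+ Q (λ i → subsetSum Q (t i)) (λ i → subsetSum Q (t′ i)))

pairSum-transpose : ∀ {n} (Q : Subset n) t → pairSum Q (λ i j → t j i) ≡ pairSum Q t
pairSum-transpose Q t = subsetSum-comm Q Q (λ i j → t j i)

pairSum-remove : ∀ {n} (Q : Subset n) u {t} → (∀ i j → 0ℚ ≤ t i j) →
                 pairSum Q t ≤ pairSum (Q - u) t + subsetSum Q (λ j → t u j + t j u)
pairSum-remove Q u {t} t≥0 = begin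
  pairSum Q t
    ≤⟨ subsetSum-remove Q u (λ i → subsetSum-nonneg Q (t≥0 i)) ⟩
  subsetSum Q′ (λ i → subsetSum Q (t i)) + out
    ≤⟨ +-monoˡ-≤ out (subsetSum-mono-≤ Q′ (λ i → subsetSum-remove Q u (t≥0 i))) ⟩
  subsetSum Q′ (λ i → subsetSum Q′ (t i) + t i u) + out
    ≡⟨ cong (_+ out) (subsetSum-distrib-+ Q′ (λ i → subsetSum Q′ (t i)) (λ i → t i u)) ⟩
  pairSum Q′ t + subsetSum Q′ (λ i → t i u) + out
    ≤⟨ +-monoˡ-≤ out (+-monoʳ-≤ (pairSum Q′ t)
                         (subsetSum-mono-⊆ (λ i → t≥0 i u) (p─q⊆p Q ⁅ u ⁆))) ⟩
  pairSum Q′ t + into + out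
    ≡⟨ +-assoc (pairSum Q′ t) into out ⟩
  pairSum Q′ t + (into + out)
    ≡⟨ cong (pairSum Q′ t +_) (trans (+-comm into out) (sym (subsetSum-distrib-+ Q (t u) (λ j → t j u)))) ⟩
  pairSum Q′ t + subsetSum Q (λ j → t u j + t j u)
    ∎
  where
  open ≤-Reasoning
  Q′ = Q - u
  out = subsetSum Q (t u)
  into = subsetSum Q (λ i → t i u)

upper : ∀ {n} → (Fin n → Fin n → ℚ) → Fin n → Fin n → ℚ
upper t i j = [ toℕ i ℕ.<ᵇ toℕ j ]ℚ (t i j)

upper-split : ∀ {n} (t : Fin n → Fin n → ℚ) → (∀ i j → t i j ≡ t j i) → (∀ i → t i i ≡ 0ℚ) →
              ∀ i j → t i j ≡ upper t i j + upper t j i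
upper-split t t-sym t-diag i j
  with toℕ i ℕ.<ᵇ toℕ j | ℕ.<ᵇ-reflects-< (toℕ i) (toℕ j)
     | toℕ j ℕ.<ᵇ toℕ i | ℕ.<ᵇ-reflects-< (toℕ j) (toℕ i)
... | true  | ofʸ i<j | true  | ofʸ j<i = contradiction j<i (ℕ.<⇒≯ i<j)
... | true  | _       | false | _       = sym (+-identityʳ (t i j))
... | false | _       | true  | _       = trans (t-sym i j) (sym (+-identityˡ (t j i)))
... | false | ofⁿ i≮j | false | ofⁿ j≮i
  with Fin.toℕ-injective (ℕ.≤-antisym (ℕ.≮⇒≥ j≮i) (ℕ.≮⇒≥ i≮j))
...   | refl = t-diag i

module _ {n : ℕ} (G : WGraph n) where
  open WGraph G

  -- S₂ is unconstrained off the edges; masking it by adj gives a symmetric, nonnegative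
  -- matrix with zero diagonal, which is all the sums below need.
  edgeWeight : Fin n → Fin n → ℚ
  edgeWeight i j = [ adj i j ]ℚ (S₂ i j)

  edgeWeight-nonneg : ∀ i j → 0ℚ ≤ edgeWeight i j
  edgeWeight-nonneg i j with adj i j in ij∈E
  ... | true  = S₂-nonneg i j ij∈E
  ... | false = ≤-refl

  edgeWeight-sym : ∀ i j → edgeWeight i j ≡ edgeWeight j i
  edgeWeight-sym i j rewrite adj-sym i j with adj j i in ji∈E
  ... | true  = S₂-sym i j (trans (adj-sym i j) ji∈E)
  ... | false = refl

  edgeWeight-diag : ∀ i → edgeWeight i i ≡ 0ℚ
  edgeWeight-diag i rewrite adj-irr i = refl

  edgeWeight-split : ∀ i j → edgeWeight i j ≡ upper edgeWeight i j + upper edgeWeight j i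
  edgeWeight-split = upper-split edgeWeight edgeWeight-sym edgeWeight-diag

  edgeSum≡pairSum : ∀ Q → edgeSum G Q ≡ pairSum Q (upper edgeWeight)
  edgeSum≡pairSum Q = sym (begin
    pairSum Q (upper edgeWeight)
      ≡⟨ ∑-cong (λ i → guard-∑ (lookup Q i) (λ j → [ lookup Q j ]ℚ (upper edgeWeight i j))) ⟩
    ∑ (λ i → ∑ (λ j → [ lookup Q i ]ℚ ([ lookup Q j ]ℚ (upper edgeWeight i j))))
      ≡⟨ ∑-cong (λ i → ∑-cong (λ j →
           reorder (lookup Q i) (lookup Q j) (toℕ i ℕ.<ᵇ toℕ j) (adj i j) (S₂ i j))) ⟩
    edgeSum G Q
      ∎)
    where
    open ≡-Reasoning
    reorder : ∀ p q l a x → [ p ]ℚ ([ q ]ℚ ([ l ]ℚ ([ a ]ℚ x))) ≡ [ l ∧ a ∧ p ∧ q ]ℚ x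
    reorder p q true  true  x = sym (guard-∧ p q x)
    reorder p q true  false x = trans (cong [ p ]ℚ (guard-0 q)) (guard-0 p)
    reorder p q false a     x = trans (cong [ p ]ℚ (guard-0 q)) (guard-0 p)

  w≡degree+S₁ : ∀ u Q → w G u Q ≡ subsetSum Q (edgeWeight u) + S₁ u
  w≡degree+S₁ u Q = cong (_+ S₁ u) (∑-cong {f = λ j → [ adj u j ∧ lookup Q j ]ℚ (S₂ u j)} λ j →
    trans (guard-∧ (adj u j) (lookup Q j) (S₂ u j)) (guard-comm (adj u j) (lookup Q j) (S₂ u j)))

  w-mono-⊆ : ∀ u {Q P} → Q ⊆ P → w G u Q ≤ w G u P
  w-mono-⊆ u {Q} {P} Q⊆P rewrite w≡degree+S₁ u Q | w≡degree+S₁ u P =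
    +-monoˡ-≤ (S₁ u) (subsetSum-mono-⊆ (edgeWeight-nonneg u) Q⊆P)

  mass : Subset n → ℚ
  mass Q = edgeSum G Q + nodeSum G Q

  mass-⊥ : mass ⊥ ≡ 0ℚ
  mass-⊥ = cong₂ _+_
    (trans (edgeSum≡pairSum ⊥) (subsetSum-⊥ (λ i → subsetSum ⊥ (upper edgeWeight i))))
    (subsetSum-⊥ S₁)

  mass-remove : ∀ Q u → mass Q ≤ mass (Q - u) + w G u Q
  mass-remove Q u = begin
    mass Q
      ≡⟨ cong (_+ nodeSum G Q) (edgeSum≡pairSum Q) ⟩
    pairSum Q up + subsetSum Q S₁
      ≤⟨ +-mono-≤ (pairSum-remove Q u (λ i j → guard-nonneg (toℕ i ℕ.<ᵇ toℕ j) (edgeWeight-nonneg i j)))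
                  (subsetSum-remove Q u S₁-nonneg) ⟩
    (pairSum Q′ up + degree) + (subsetSum Q′ S₁ + S₁ u)
      ≡⟨ interchange (pairSum Q′ up) degree (subsetSum Q′ S₁) (S₁ u) ⟩
    (pairSum Q′ up + subsetSum Q′ S₁) + (degree + S₁ u)
      ≡⟨ cong₂ _+_ (cong (_+ subsetSum Q′ S₁) (edgeSum≡pairSum Q′))
                   (trans (w≡degree+S₁ u Q) (cong (_+ S₁ u) (subsetSum-cong Q (edgeWeight-split u)))) ⟨
    mass Q′ + w G u Q
      ∎
    where
    open ≤-Reasoning
    up = upper edgeWeight
    Q′ = Q - u
    degree = subsetSum Q (λ j → up u j + up j u)

  handshake : ∀ Q → subsetSum Q (λ v → w G v Q) ≤ mass Q + mass Q
  handshake Q = begin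
    subsetSum Q (λ v → w G v Q)
      ≡⟨ subsetSum-cong Q (λ v → w≡degree+S₁ v Q) ⟩
    subsetSum Q (λ v → subsetSum Q (edgeWeight v) + S₁ v)
      ≡⟨ subsetSum-distrib-+ Q (λ v → subsetSum Q (edgeWeight v)) S₁ ⟩
    pairSum Q edgeWeight + N
      ≡⟨ cong (_+ N) (subsetSum-cong Q (λ i → subsetSum-cong Q (edgeWeight-split i))) ⟩
    pairSum Q (λ i j → up i j + up j i) + N
      ≡⟨ cong (_+ N) (trans (pairSum-distrib-+ Q up (λ i j → up j i))
                            (cong (pairSum Q up +_) (pairSum-transpose Q up))) ⟩
    (E + E) + N
      ≤⟨ +-monoʳ-≤ (E + E) (p≤p+q (subsetSum-nonneg Q S₁-nonneg)) ⟩
    (E + E) + (N + N)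
      ≡⟨ interchange E E N N ⟩
    (E + N) + (E + N)
      ≡⟨ cong (λ e → (e + N) + (e + N)) (edgeSum≡pairSum Q) ⟨
    mass Q + mass Q
      ∎
    where
    open ≤-Reasoning
    up = upper edgeWeight
    E = pairSum Q up
    N = nodeSum G Q

  avgW≤2𝓕 : ∀ Q → avgW G Q ≤ 𝓕 G Q + 𝓕 G Q
  avgW≤2𝓕 Q = ≤-trans (avg-mono-≤ ∣ Q ∣ (handshake Q))
                      (≤-reflexive (avg-distrib-+ (mass Q) (mass Q) ∣ Q ∣))

  mass≤c*∣Q∣ : ∀ c → (∀ Q → Nonempty Q → 𝓕 G Q ≤ c) → ∀ Q → mass Q ≤ c * fromℕ ∣ Q ∣
  mass≤c*∣Q∣ c 𝓕≤c Q with nonempty? Q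
  ... | yes (x , x∈Q) = avg-≤⇒≤-* (∣p∣≡1+∣p-x∣ x∈Q) (𝓕≤c Q (x , x∈Q))
  ... | no  Q-empty rewrite Empty-unique Q-empty | ∣⊥∣≡0 n =
    ≤-reflexive (trans mass-⊥ (sym (*-zeroʳ c)))

  Densest : Subset n → Set
  Densest Qs = ∀ Q → Nonempty Q → 𝓕 G Q ≤ 𝓕 G Qs

  𝓕-densest≤w : ∀ {Qs u} → Densest Qs → u ∈ₛ Qs → 𝓕 G Qs ≤ w G u Qs
  𝓕-densest≤w {Qs} {u} Qs-densest u∈Qs =
    avg-peel ∣ Qs - u ∣ (∣p∣≡1+∣p-x∣ u∈Qs)
             (mass≤c*∣Q∣ (𝓕 G Qs) Qs-densest (Qs - u)) (mass-remove Qs u)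

  ½𝓕-densest≤𝓕 : ∀ {Qs V u} → Densest Qs → Qs ⊆ V → u ∈ₛ Qs → InR G V u →
                 ½ * 𝓕 G Qs ≤ 𝓕 G V
  ½𝓕-densest≤𝓕 {Qs} {V} {u} Qs-densest Qs⊆V u∈Qs (_ , w≤avgW) = begin
    ½ * 𝓕 G Qs            ≤⟨ *-monoˡ-≤-nonNeg ½ 𝓕Qs≤2𝓕V ⟩
    ½ * (𝓕 G V + 𝓕 G V)   ≡⟨ ½*[x+x]≡x (𝓕 G V) ⟩
    𝓕 G V                 ∎
    where
    open ≤-Reasoning
    𝓕Qs≤2𝓕V : 𝓕 G Qs ≤ 𝓕 G V + 𝓕 G V
    𝓕Qs≤2𝓕V = begin
      𝓕 G Qs         ≤⟨ 𝓕-densest≤w Qs-densest u∈Qs ⟩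
      w G u Qs       ≤⟨ w-mono-⊆ u Qs⊆V ⟩
      w G u V        ≤⟨ w≤avgW ⟩
      avgW G V       ≤⟨ avgW≤2𝓕 V ⟩
      𝓕 G V + 𝓕 G V  ∎

  removeAll-⊆-or-meets : ∀ {P S} L → P ⊆ S → P ⊆ removeAll G S L ⊎ ∃[ x ] (x ∈ₛ P × x ∈ L)
  removeAll-⊆-or-meets         []      P⊆S = inj₁ P⊆S
  removeAll-⊆-or-meets {P} {S} (x ∷ L) P⊆S with x ∈? P
  ... | yes x∈P = inj₂ (x , x∈P , here refl)
  ... | no  x∉P = Sum.map₂ (Product.map₂ (Product.map₂ there)) (removeAll-⊆-or-meets L P⊆S-x)
    where
    P⊆S-x : P ⊆ S - x
    P⊆S-x y∈P = x∈p∧x≢y⇒x∈p-y (P⊆S y∈P) (λ { refl → x∉P y∈P })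

  removeAll∈removals : ∀ S L → removeAll G S L ∈ S ∷ removals G S L
  removeAll∈removals S []      = here refl
  removeAll∈removals S (x ∷ L) = there (removeAll∈removals (S - x) L)

  recorded-step : ∀ {S L recs V} → V ∈ removeAll G S L ∷ recs → V ∈ S ∷ removals G S L ++ recs
  recorded-step {S} {L} (here refl)    = ∈-++⁺ˡ (removeAll∈removals S L)
  recorded-step {S} {L} (there V∈recs) = ∈-++⁺ʳ (S ∷ removals G S L) V∈recs

  run-meets : ∀ {V recs P} → Run G V recs → Nonempty P → P ⊆ V →
              ∃[ V′ ] (V′ ∈ V ∷ recs × Nonempty V′ × P ⊆ V′ × ∃[ u ] (u ∈ₛ P × InR G V′ u))
  run-meets (stop V-empty) (x , x∈P) P⊆V = contradiction (x , P⊆V x∈P) V-empty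
  run-meets {V} (step {L = L} V-nonempty (_ , L≡R , _) run) P-nonempty P⊆V
    with removeAll-⊆-or-meets L P⊆V
  ... | inj₁ P⊆V′            = Product.map₂ (Product.map₁ recorded-step) (run-meets run P-nonempty P⊆V′)
  ... | inj₂ (u , u∈P , u∈L) = V , here refl , V-nonempty , P⊆V , u , u∈P , Equivalence.to (L≡R u) u∈L

theorem3 : (m : ℕ) (G : WGraph (suc m))
    (recs : List (Subset (suc m))) → Run G ⊤ recs →
    (Q : Subset (suc m)) → Q ∈ (⊤ ∷ recs) → Nonempty Q →
    (∀ Q′ → Q′ ∈ (⊤ ∷ recs) → Nonempty Q′ → 𝓕 G Q′ ≤ 𝓕 G Q) →
    (Qs : Subset (suc m)) → Nonempty Qs →
    (∀ Q′ → Nonempty Q′ → 𝓕 G Q′ ≤ 𝓕 G Qs) →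
    ½ * 𝓕 G Qs ≤ 𝓕 G Q
theorem3 m G recs run Q _ _ Q-max Qs Qs-nonempty Qs-densest
  with run-meets G run Qs-nonempty ⊆⊤
... | V , V∈recs , V-nonempty , Qs⊆V , u , u∈Qs , u∈R =
  ≤-trans (½𝓕-densest≤𝓕 G Qs-densest Qs⊆V u∈Qs u∈R) (Q-max V V∈recs V-nonempty)
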